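{- Let $n$ be a positive integer with $n\equiv 3\pmod 4$. Then there exists an $SMR(2,n;n,2)$.
   Context: A signed magic rectangle $SMR(m,n;r,s)$ is an $m\times n$ array, some of whose cells are filled with integers and the others empty, such that exactly $r$ cells in every row and exactly $s$ cells in every column are filled (so $mr=ns$), every element of $X$ appears exactly once in the array, and the sum of the entries of each row and of each column is zero, where (for $mr$ even) $X=\{\pm1,\pm2,\ldots,\pm mr/2\}$. -}

module Defs where

open import Data.Nat as ℕ using (ℕ; zero; suc)
open import Data.Integer as ℤ using (ℤ; +_; ∣_∣)
open import Data.Fin using (Fin)
import Data.Fin
open import Data.Maybe using (Maybe; just; nothing)
open import Data.Product using (_×_; Σ; ∃)
open import Relation.Binary.PropositionalEquality using (_≡_; _≢_)
open import Relation.Nullary using (does)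
open import Data.Bool using (if_then_else_)

sumFinℕ : ∀ {n} → (Fin n → ℕ) → ℕ
sumFinℕ {zero}  f = 0
sumFinℕ {suc n} f = f Data.Fin.zero ℕ.+ sumFinℕ (λ i → f (Data.Fin.suc i))


sumFinℤ : ∀ {n} → (Fin n → ℤ) → ℤ
sumFinℤ {zero}  f = + 0
sumFinℤ {suc n} f = f Data.Fin.zero ℤ.+ sumFinℤ (λ i → f (Data.Fin.suc i))


-- A partially filled m × n array: `nothing` = empty cell.
PArray : ℕ → ℕ → Set
PArray m n = Fin m → Fin n → Maybe ℤ

filled : Maybe ℤ → ℕ
filled nothing  = 0
filled (just _) = 1

value : Maybe ℤ → ℤ
value nothing  = + 0
value (just x) = x

isEntry : ℤ → Maybe ℤ → ℕ
isEntry x nothing  = 0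
isEntry x (just y) = if does (x ℤ.≟ y) then 1 else 0

occurrences : ∀ {m n} → PArray m n → ℤ → ℕ
occurrences {m} {n} A x = sumFinℕ (λ i → sumFinℕ (λ j → isEntry x (A i j)))

InX : ℕ → ℤ → Set
InX k x = x ≢ + 0 × ∣ x ∣ ℕ.≤ k

-- Signed magic rectangle SMR(m,n;r,s), for mr even (mr = 2k,
-- X = {±1,…,±k}).
record IsSMR (m n r s : ℕ) (A : PArray m n) : Set where
  field
    mr≡ns      : m ℕ.* r ≡ n ℕ.* s
    rowFilled  : ∀ i → sumFinℕ (λ j → filled (A i j)) ≡ r
    colFilled  : ∀ j → sumFinℕ (λ i → filled (A i j)) ≡ s
    entriesInX : ∀ i j x → A i j ≡ just x → InX (m ℕ.* r ℕ./ 2) x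
    eachOnce   : ∀ x → InX (m ℕ.* r ℕ./ 2) x → occurrences A x ≡ 1
    rowSum     : ∀ i → sumFinℤ (λ j → value (A i j)) ≡ + 0
    colSum     : ∀ j → sumFinℤ (λ i → value (A i j)) ≡ + 0

SMR : ℕ → ℕ → ℕ → ℕ → Set
SMR m n r s = Σ (PArray m n) (IsSMR m n r s)

-- Put the entries ±1, …, ±n in two rows, the second row being the negation of the first,
-- so every column sums to zero.  For the first row take the signs − − + followed by
-- blocks + − − +, i.e. −1 − 2 + 3 + Σₖ ((4k+4) − (4k+5) − (4k+6) + (4k+7)), each part
-- summing to zero; this needs n ≡ 3 (mod 4).
module Submission where

open import Defs
open import Data.Nat using (ℕ; _%_; _>_)
open import Relation.Binary.PropositionalEquality using (_≡_)

open import Data.Nat as ℕ using (zero; suc; _<_)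
import Data.Nat.Properties as ℕ
open import Data.Nat.DivMod using (m≡m%n+[m/n]*n; m*n/n≡m)
open import Data.Integer as ℤ using (ℤ; +_; -[1+_]; +[1+_]; ∣_∣; -_)
import Data.Integer.Properties as ℤ
open import Data.Integer.Solver using (module +-*-Solver)
open import Data.Fin using (Fin; toℕ; fromℕ<)
import Data.Fin.Properties as Fin
open import Data.Bool using (Bool; true; false; if_then_else_)
open import Data.Maybe using (just)
open import Data.Product using (_,_)
open import Data.Empty using (⊥-elim)
open import Relation.Nullary using (yes; no)
open import Relation.Binary.PropositionalEquality
  using (_≢_; refl; sym; trans; cong; cong₂; subst; module ≡-Reasoning)

open ≡-Reasoning

sumFinℕ-1 : ∀ n → sumFinℕ {n} (λ _ → 1) ≡ n
sumFinℕ-1 zero    = refl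
sumFinℕ-1 (suc n) = cong suc (sumFinℕ-1 n)

sumFinℕ-zero : ∀ {n} (f : Fin n → ℕ) → (∀ j → f j ≡ 0) → sumFinℕ f ≡ 0
sumFinℕ-zero {zero}  f f≡0 = refl
sumFinℕ-zero {suc n} f f≡0 =
  cong₂ ℕ._+_ (f≡0 Fin.zero) (sumFinℕ-zero (λ j → f (Fin.suc j)) (λ j → f≡0 (Fin.suc j)))

sumFinℕ-single : ∀ {n} (f : Fin n → ℕ) p → (∀ j → j ≢ p → f j ≡ 0) → sumFinℕ f ≡ f p
sumFinℕ-single {suc n} f Fin.zero f≡0 = begin
  f Fin.zero ℕ.+ sumFinℕ (λ j → f (Fin.suc j))
    ≡⟨ cong (f Fin.zero ℕ.+_) (sumFinℕ-zero _ (λ j → f≡0 (Fin.suc j) (λ ()))) ⟩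
  f Fin.zero ℕ.+ 0
    ≡⟨ ℕ.+-identityʳ (f Fin.zero) ⟩
  f Fin.zero ∎
sumFinℕ-single {suc n} f (Fin.suc p) f≡0 =
  cong₂ ℕ._+_ (f≡0 Fin.zero (λ ()))
    (sumFinℕ-single (λ j → f (Fin.suc j)) p
      (λ j j≢p → f≡0 (Fin.suc j) (λ eq → j≢p (Fin.suc-injective eq))))

sumFinℤ-neg : ∀ {n} (f : Fin n → ℤ) → sumFinℤ (λ j → - f j) ≡ - sumFinℤ f
sumFinℤ-neg {zero}  f = refl
sumFinℤ-neg {suc n} f = begin
  (- f Fin.zero) ℤ.+ sumFinℤ (λ j → - f (Fin.suc j))
    ≡⟨ cong (λ s → (- f Fin.zero) ℤ.+ s) (sumFinℤ-neg (λ j → f (Fin.suc j))) ⟩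
  (- f Fin.zero) ℤ.+ (- sumFinℤ (λ j → f (Fin.suc j)))
    ≡⟨ sym (ℤ.neg-distrib-+ (f Fin.zero) _) ⟩
  - sumFinℤ f ∎

-- Blocks are indexed as toℕ j + o * 4 so that shifting g by 4 turns block o + 1 into block o
-- definitionally.
sumFinℤ-blocks : ∀ k (g : ℕ → ℤ) →
                 (∀ o → sumFinℤ {4} (λ j → g (toℕ j ℕ.+ o ℕ.* 4)) ≡ + 0) →
                 sumFinℤ {k ℕ.* 4} (λ j → g (toℕ j)) ≡ + 0
sumFinℤ-blocks zero    g blocks = refl
sumFinℤ-blocks (suc k) g blocks = begin
  g 0 ℤ.+ (g 1 ℤ.+ (g 2 ℤ.+ (g 3 ℤ.+ rest)))
    ≡⟨ cong (λ s → g 0 ℤ.+ (g 1 ℤ.+ (g 2 ℤ.+ (g 3 ℤ.+ s))))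
            (sumFinℤ-blocks k (λ i → g (4 ℕ.+ i)) (λ o → blocks (suc o))) ⟩
  g 0 ℤ.+ (g 1 ℤ.+ (g 2 ℤ.+ (g 3 ℤ.+ + 0)))
    ≡⟨ blocks 0 ⟩
  + 0 ∎
  where rest = sumFinℤ {k ℕ.* 4} (λ j → g (4 ℕ.+ toℕ j))

isEntry-self : ∀ x → isEntry x (just x) ≡ 1
isEntry-self x with x ℤ.≟ x
... | yes _   = refl
... | no x≢x = ⊥-elim (x≢x refl)

isEntry-≢ : ∀ {x z} → x ≢ z → isEntry x (just z) ≡ 0
isEntry-≢ {x} {z} x≢z with x ℤ.≟ z
... | yes x≡z = ⊥-elim (x≢z x≡z)
... | no _    = refl

isEntry-± : ∀ x z {b} → ∣ x ∣ ≡ suc b → ∣ z ∣ ≡ suc b →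
            isEntry x (just z) ℕ.+ isEntry x (just (- z)) ≡ 1
isEntry-± +[1+ b ] +[1+ _ ] refl refl =
  cong₂ ℕ._+_ (isEntry-self +[1+ b ]) (isEntry-≢ {+[1+ b ]} { -[1+ b ]} (λ ()))
isEntry-± +[1+ b ] -[1+ _ ] refl refl =
  cong₂ ℕ._+_ (isEntry-≢ {+[1+ b ]} { -[1+ b ]} (λ ())) (isEntry-self +[1+ b ])
isEntry-± -[1+ b ] +[1+ _ ] refl refl =
  cong₂ ℕ._+_ (isEntry-≢ { -[1+ b ]} {+[1+ b ]} (λ ())) (isEntry-self -[1+ b ])
isEntry-± -[1+ b ] -[1+ _ ] refl refl =
  cong₂ ℕ._+_ (isEntry-self -[1+ b ]) (isEntry-≢ { -[1+ b ]} {+[1+ b ]} (λ ()))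

sumFinℕ-isEntry : ∀ {n b} x (f : ℕ → ℤ) → (∀ i → ∣ f i ∣ ≡ suc i) → b < n → ∣ x ∣ ≡ suc b →
                  sumFinℕ {n} (λ j → isEntry x (just (f (toℕ j)))) ≡ isEntry x (just (f b))
sumFinℕ-isEntry {n} {b} x f ∣f∣ b<n ∣x∣ = begin
  sumFinℕ {n} (λ j → isEntry x (just (f (toℕ j))))
    ≡⟨ sumFinℕ-single _ p (λ j j≢p → isEntry-≢ (λ x≡fj → j≢p (only-p j x≡fj))) ⟩
  isEntry x (just (f (toℕ p)))
    ≡⟨ cong (λ i → isEntry x (just (f i))) (Fin.toℕ-fromℕ< b<n) ⟩
  isEntry x (just (f b)) ∎
  where
  p = fromℕ< b<n
  only-p : ∀ j → x ≡ f (toℕ j) → j ≡ p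
  only-p j x≡fj = Fin.toℕ-injective (begin
    toℕ j  ≡⟨ ℕ.suc-injective (trans (sym (∣f∣ (toℕ j))) (trans (cong ∣_∣ (sym x≡fj)) ∣x∣)) ⟩
    b      ≡⟨ Fin.toℕ-fromℕ< b<n ⟨
    toℕ p  ∎)

InX-∣∣≡suc : ∀ {k x b} → ∣ x ∣ ≡ suc b → b < k → InX k x
InX-∣∣≡suc ∣x∣ b<k = (λ { refl → ℕ.0≢1+n ∣x∣ }) , subst (ℕ._≤ _) (sym ∣x∣) b<k

positive : ℕ → Bool
positive 0 = false
positive 1 = false
positive 2 = true
positive 3 = true
positive (suc (suc (suc (suc i)))) = positive i

positive-periodic : ∀ j o → positive (j ℕ.+ o ℕ.* 4) ≡ positive j
positive-periodic j o = trans (cong positive (ℕ.+-comm j (o ℕ.* 4))) (shift o)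
  where
  shift : ∀ o → positive (o ℕ.* 4 ℕ.+ j) ≡ positive j
  shift zero    = refl
  shift (suc o) = shift o

entry : ℕ → ℤ
entry i = if positive i then +[1+ i ] else -[1+ i ]

∣entry∣ : ∀ i → ∣ entry i ∣ ≡ suc i
∣entry∣ i with positive i
... | true  = refl
... | false = refl

∣-entry∣ : ∀ i → ∣ - entry i ∣ ≡ suc i
∣-entry∣ i = trans (ℤ.∣-i∣≡∣i∣ (entry i)) (∣entry∣ i)

+−−+≡0 : ∀ m → +[1+ m ] ℤ.+ (-[1+ 1 ℕ.+ m ] ℤ.+ (-[1+ 2 ℕ.+ m ] ℤ.+ (+[1+ 3 ℕ.+ m ] ℤ.+ + 0))) ≡ + 0
+−−+≡0 m = solve 1 (λ x → (con (+ 1) :+ x) :+ (:- (con (+ 2) :+ x) :+ (:- (con (+ 3) :+ x)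
                    :+ ((con (+ 4) :+ x) :+ con (+ 0)))) := con (+ 0)) refl (+ m)
  where open +-*-Solver

entry-block : ∀ o → sumFinℤ {4} (λ j → entry (3 ℕ.+ (toℕ j ℕ.+ o ℕ.* 4))) ≡ + 0
entry-block o
  rewrite positive-periodic 3 o | positive-periodic 4 o
        | positive-periodic 5 o | positive-periodic 6 o = +−−+≡0 (3 ℕ.+ o ℕ.* 4)

entry-sum : ∀ k → sumFinℤ {3 ℕ.+ k ℕ.* 4} (λ j → entry (toℕ j)) ≡ + 0
entry-sum k = cong (λ s → -[1+ 0 ] ℤ.+ (-[1+ 1 ] ℤ.+ (+[1+ 2 ] ℤ.+ s)))
                   (sumFinℤ-blocks k (λ i → entry (3 ℕ.+ i)) entry-block)

array : (n : ℕ) → PArray 2 n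
array n Fin.zero           j = just (entry (toℕ j))
array n (Fin.suc Fin.zero) j = just (- entry (toℕ j))

array-rowSum : ∀ n → n % 4 ≡ 3 → ∀ i → sumFinℤ (λ j → value (array n i j)) ≡ + 0
array-rowSum n n%4≡3 Fin.zero =
  subst (λ m → sumFinℤ {m} (λ j → entry (toℕ j)) ≡ + 0) (sym n≡3+[n/4]*4) (entry-sum (n ℕ./ 4))
  where
  n≡3+[n/4]*4 : n ≡ 3 ℕ.+ n ℕ./ 4 ℕ.* 4
  n≡3+[n/4]*4 = trans (m≡m%n+[m/n]*n n 4) (cong (ℕ._+ n ℕ./ 4 ℕ.* 4) n%4≡3)
array-rowSum n n%4≡3 (Fin.suc Fin.zero) = begin
  sumFinℤ {n} (λ j → - entry (toℕ j))  ≡⟨ sumFinℤ-neg {n} (λ j → entry (toℕ j)) ⟩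
  - sumFinℤ {n} (λ j → entry (toℕ j))  ≡⟨ cong -_ (array-rowSum n n%4≡3 Fin.zero) ⟩
  + 0                                   ∎

array-colSum : ∀ n j → sumFinℤ (λ i → value (array n i j)) ≡ + 0
array-colSum n j = trans (cong (λ s → a ℤ.+ s) (ℤ.+-identityʳ (- a))) (ℤ.+-inverseʳ a)
  where a = entry (toℕ j)

array-entries : ∀ n i j x → array n i j ≡ just x → InX n x
array-entries n Fin.zero           j x refl = InX-∣∣≡suc (∣entry∣ (toℕ j)) (Fin.toℕ<n j)
array-entries n (Fin.suc Fin.zero) j x refl = InX-∣∣≡suc (∣-entry∣ (toℕ j)) (Fin.toℕ<n j)

array-occurrences : ∀ n x → InX n x → occurrences (array n) x ≡ 1
array-occurrences n x (x≢0 , ∣x∣≤n) with ∣ x ∣ in ∣x∣≡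
... | zero  = ⊥-elim (x≢0 (ℤ.∣i∣≡0⇒i≡0 ∣x∣≡))
... | suc b = begin
  row entry ℕ.+ (row (λ i → - entry i) ℕ.+ 0)
    ≡⟨ cong (row entry ℕ.+_) (ℕ.+-identityʳ _) ⟩
  row entry ℕ.+ row (λ i → - entry i)
    ≡⟨ cong₂ ℕ._+_ (sumFinℕ-isEntry x entry ∣entry∣ ∣x∣≤n ∣x∣≡)
                   (sumFinℕ-isEntry x (λ i → - entry i) ∣-entry∣ ∣x∣≤n ∣x∣≡) ⟩
  isEntry x (just (entry b)) ℕ.+ isEntry x (just (- entry b))
    ≡⟨ isEntry-± x (entry b) ∣x∣≡ (∣entry∣ b) ⟩
  1 ∎
  where
  row : (ℕ → ℤ) → ℕ
  row f = sumFinℕ {n} (λ j → isEntry x (just (f (toℕ j))))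

2*n/2≡n : ∀ n → 2 ℕ.* n ℕ./ 2 ≡ n
2*n/2≡n n = trans (cong (ℕ._/ 2) (ℕ.*-comm 2 n)) (m*n/n≡m n 2)

lemma15 : (n : ℕ) → n > 0 → n % 4 ≡ 3 → SMR 2 n n 2
lemma15 n _ n%4≡3 = array n , record
  { mr≡ns      = ℕ.*-comm 2 n
  ; rowFilled  = λ { Fin.zero → sumFinℕ-1 n ; (Fin.suc Fin.zero) → sumFinℕ-1 n }
  ; colFilled  = λ _ → refl
  ; entriesInX = λ i j x eq → subst (λ k → InX k x) (sym (2*n/2≡n n)) (array-entries n i j x eq)
  ; eachOnce   = λ x x∈X → array-occurrences n x (subst (λ k → InX k x) (2*n/2≡n n) x∈X)
  ; rowSum     = array-rowSum n n%4≡3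
  ; colSum     = array-colSum n
  }
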